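{- Let $\mathcal Q$ be a quantale. The set $\mathcal A=\{a\in\mathcal Q\mid a\text{ is strongly square increasing}\}$ is a subquantale of $\mathcal Q$.
   Context: A quantale is a complete join-semilattice with an associative multiplication distributing over arbitrary joins on both sides. A subquantale is a subset closed under multiplication and arbitrary joins. An element $a$ is strongly square increasing if for all $b$, $a\cdot b\le a\cdot b\cdot a$ and $b\cdot a\le a\cdot b\cdot a$. -}

module Defs where

open import Level using (Level; suc; _⊔_)
open import Relation.Binary.PropositionalEquality using (_≡_)
open import Relation.Binary.Structures using (IsPartialOrder)

-- A quantale: a complete join-semilattice (arbitrary joins of families indexed
-- by any type I : Set c; this covers all subsets S of the carrier via I = Σ Carrier S)
-- with an associative multiplication distributing over arbitrary joins on both sides.
record Quantale (c ℓ : Level) : Set (suc (c ⊔ ℓ)) where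
  infixl 7 _·_
  infix 4 _≤_
  field
    Carrier        : Set c
    _≤_            : Carrier → Carrier → Set ℓ
    isPartialOrder : IsPartialOrder _≡_ _≤_
    ⋁              : {I : Set c} → (I → Carrier) → Carrier
    ⋁-upper        : {I : Set c} (f : I → Carrier) (i : I) → f i ≤ ⋁ f
    ⋁-least        : {I : Set c} (f : I → Carrier) (u : Carrier) →
                     (∀ i → f i ≤ u) → ⋁ f ≤ u
    _·_            : Carrier → Carrier → Carrier
    ·-assoc        : ∀ x y z → (x · y) · z ≡ x · (y · z)
    ·-distribˡ-⋁   : ∀ (a : Carrier) {I : Set c} (f : I → Carrier) →
                     a · ⋁ f ≡ ⋁ (λ i → a · f i)
    ·-distribʳ-⋁   : ∀ (a : Carrier) {I : Set c} (f : I → Carrier) →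
                     ⋁ f · a ≡ ⋁ (λ i → f i · a)

module _ {c ℓ : Level} (Q : Quantale c ℓ) where
  open Quantale Q

  StronglySquareIncreasing : Carrier → Set (c ⊔ ℓ)
  StronglySquareIncreasing a = ∀ b → (a · b ≤ a · b · a) × (b · a ≤ a · b · a)
    where open import Data.Product using (_×_)

  record IsSubquantale {p : Level} (S : Carrier → Set p) : Set (suc c ⊔ p) where
    field
      ·-closed : ∀ {x y} → S x → S y → S (x · y)
      ⋁-closed : {I : Set c} (f : I → Carrier) → (∀ i → S (f i)) → S (⋁ f)

-- The two inequalities a·b ≤ a·b·a and b·a ≤ a·b·a are each preserved on their
-- own.  For a product a·d, apply the hypothesis on a to the element d·b and then
-- the one on d to b·a (resp. d first, then a).  For a join ⋁ f, distributivity
-- reduces the claim to fᵢ·b ≤ fᵢ·b·fᵢ ≤ (⋁ f)·b·(⋁ f), which needs only that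
-- multiplication is monotone; monotonicity in turn is distributivity over the
-- binary join x ∨ y, which equals y when x ≤ y.
module Submission where

open import Level using (Level; _⊔_; Lift; lift)
open import Defs
open import Data.Bool using (Bool; true; false)
open import Data.Product using (_,_; proj₁; proj₂)
open import Relation.Binary.PropositionalEquality using (_≡_; cong)
open import Relation.Binary.Bundles using (Poset)
open import Function using (_∘_)
import Relation.Binary.Reasoning.PartialOrder as PosetReasoning

module QuantaleProperties {c ℓ : Level} (Q : Quantale c ℓ) where
  open Quantale Q

  poset : Poset c c ℓ
  poset = record { isPartialOrder = isPartialOrder }

  open Poset poset using (antisym) renaming (refl to ≤-refl)
  open PosetReasoning poset

  pair : Carrier → Carrier → Lift c Bool → Carrier
  pair x y (lift false) = x
  pair x y (lift true)  = y

  _∨_ : Carrier → Carrier → Carrier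
  x ∨ y = ⋁ (pair x y)

  x≤y⇒x∨y≡y : ∀ {x y} → x ≤ y → x ∨ y ≡ y
  x≤y⇒x∨y≡y {x} {y} x≤y =
    antisym (⋁-least (pair x y) y λ { (lift false) → x≤y ; (lift true) → ≤-refl })
            (⋁-upper (pair x y) (lift true))

  ·-monoʳ-≤ : ∀ z {x y} → x ≤ y → z · x ≤ z · y
  ·-monoʳ-≤ z {x} {y} x≤y = begin
    z · x                                              ≤⟨ ⋁-upper _ (lift false) ⟩
    ⋁ (λ i → z · pair x y i)                           ≡⟨ ·-distribˡ-⋁ z (pair x y) ⟨
    z · (x ∨ y)                                        ≡⟨ cong (z ·_) (x≤y⇒x∨y≡y x≤y) ⟩
    z · y                                              ∎

  ·-monoˡ-≤ : ∀ z {x y} → x ≤ y → x · z ≤ y · z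
  ·-monoˡ-≤ z {x} {y} x≤y = begin
    x · z                                              ≤⟨ ⋁-upper _ (lift false) ⟩
    ⋁ (λ i → pair x y i · z)                           ≡⟨ ·-distribʳ-⋁ z (pair x y) ⟨
    (x ∨ y) · z                                        ≡⟨ cong (_· z) (x≤y⇒x∨y≡y x≤y) ⟩
    y · z                                              ∎

  ·-mono-≤ : ∀ {x x′ y y′} → x ≤ x′ → y ≤ y′ → x · y ≤ x′ · y′
  ·-mono-≤ {x} {x′} {y} {y′} x≤x′ y≤y′ = begin
    x · y    ≤⟨ ·-monoˡ-≤ y x≤x′ ⟩
    x′ · y   ≤⟨ ·-monoʳ-≤ x′ y≤y′ ⟩
    x′ · y′  ∎

  SquareIncreasingˡ : Carrier → Set (c ⊔ ℓ)
  SquareIncreasingˡ a = ∀ b → a · b ≤ a · b · a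

  SquareIncreasingʳ : Carrier → Set (c ⊔ ℓ)
  SquareIncreasingʳ a = ∀ b → b · a ≤ a · b · a

  squareIncreasingˡ-isSubquantale : IsSubquantale Q SquareIncreasingˡ
  squareIncreasingˡ-isSubquantale = record
    { ·-closed = ·-closed
    ; ⋁-closed = ⋁-closed
    }
    where
    ·-closed : ∀ {a d} → SquareIncreasingˡ a → SquareIncreasingˡ d →
               SquareIncreasingˡ (a · d)
    ·-closed {a} {d} sa sd b = begin
      a · d · b              ≡⟨ ·-assoc a d b ⟩
      a · (d · b)            ≤⟨ sa (d · b) ⟩
      a · (d · b) · a        ≡⟨ ·-assoc a (d · b) a ⟩
      a · (d · b · a)        ≡⟨ cong (a ·_) (·-assoc d b a) ⟩
      a · (d · (b · a))      ≤⟨ ·-monoʳ-≤ a (sd (b · a)) ⟩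
      a · (d · (b · a) · d)  ≡⟨ cong (a ·_) (cong (_· d) (·-assoc d b a)) ⟨
      a · (d · b · a · d)    ≡⟨ cong (a ·_) (·-assoc (d · b) a d) ⟩
      a · (d · b · (a · d))  ≡⟨ ·-assoc a (d · b) (a · d) ⟨
      a · (d · b) · (a · d)  ≡⟨ cong (_· (a · d)) (·-assoc a d b) ⟨
      a · d · b · (a · d)    ∎

    ⋁-closed : {I : Set c} (f : I → Carrier) → (∀ i → SquareIncreasingˡ (f i)) →
               SquareIncreasingˡ (⋁ f)
    ⋁-closed f sf b = begin
      ⋁ f · b                ≡⟨ ·-distribʳ-⋁ b f ⟩
      ⋁ (λ i → f i · b)      ≤⟨ ⋁-least _ _ (λ i → begin
        f i · b                ≤⟨ sf i b ⟩
        f i · b · f i          ≤⟨ ·-mono-≤ (·-monoˡ-≤ b (⋁-upper f i)) (⋁-upper f i) ⟩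
        ⋁ f · b · ⋁ f          ∎) ⟩
      ⋁ f · b · ⋁ f          ∎

  squareIncreasingʳ-isSubquantale : IsSubquantale Q SquareIncreasingʳ
  squareIncreasingʳ-isSubquantale = record
    { ·-closed = ·-closed
    ; ⋁-closed = ⋁-closed
    }
    where
    ·-closed : ∀ {a d} → SquareIncreasingʳ a → SquareIncreasingʳ d →
               SquareIncreasingʳ (a · d)
    ·-closed {a} {d} sa sd b = begin
      b · (a · d)            ≡⟨ ·-assoc b a d ⟨
      b · a · d              ≤⟨ sd (b · a) ⟩
      d · (b · a) · d        ≡⟨ cong (_· d) (·-assoc d b a) ⟨
      d · b · a · d          ≤⟨ ·-monoˡ-≤ d (sa (d · b)) ⟩
      a · (d · b) · a · d    ≡⟨ ·-assoc (a · (d · b)) a d ⟩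
      a · (d · b) · (a · d)  ≡⟨ cong (_· (a · d)) (·-assoc a d b) ⟨
      a · d · b · (a · d)    ∎

    ⋁-closed : {I : Set c} (f : I → Carrier) → (∀ i → SquareIncreasingʳ (f i)) →
               SquareIncreasingʳ (⋁ f)
    ⋁-closed f sf b = begin
      b · ⋁ f                ≡⟨ ·-distribˡ-⋁ b f ⟩
      ⋁ (λ i → b · f i)      ≤⟨ ⋁-least _ _ (λ i → begin
        b · f i                ≤⟨ sf i b ⟩
        f i · b · f i          ≤⟨ ·-mono-≤ (·-monoˡ-≤ b (⋁-upper f i)) (⋁-upper f i) ⟩
        ⋁ f · b · ⋁ f          ∎) ⟩
      ⋁ f · b · ⋁ f          ∎

mainTheorem9 : {c ℓ : Level} (Q : Quantale c ℓ) →
    IsSubquantale Q (StronglySquareIncreasing Q)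
mainTheorem9 Q = record
  { ·-closed = λ sa sd b → ˡ.·-closed (proj₁ ∘ sa) (proj₁ ∘ sd) b
                         , ʳ.·-closed (proj₂ ∘ sa) (proj₂ ∘ sd) b
  ; ⋁-closed = λ f sf b → ˡ.⋁-closed f (λ i → proj₁ ∘ sf i) b
                        , ʳ.⋁-closed f (λ i → proj₂ ∘ sf i) b
  }
  where
  open QuantaleProperties Q
  module ˡ = IsSubquantale squareIncreasingˡ-isSubquantale
  module ʳ = IsSubquantale squareIncreasingʳ-isSubquantale
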